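{- Let $a,d$ be positive integers that are not coprime. Then there exists a positive integer $x$ such that the additive Collatz trajectory $O_{a,d}(x)$ does not loop.
   Context: For positive integers $a,d$, the additive Collatz function is $T_{a,d}(x) = x + a$ if $x \not\equiv 0 \pmod d$ and $T_{a,d}(x) = x/d$ if $x \equiv 0 \pmod d$. $T_{a,d}^{(k)}$ denotes the $k$-th iterate. The additive Collatz trajectory of $x$ is the infinite sequence $O_{a,d}(x) = (x, T_{a,d}(x), T_{a,d}^{(2)}(x), \dots)$. A sequence $(o_0,o_1,o_2,\dots)$ is said to loop if there exist positive integers $k, N$ such that $o_n = o_{n+k}$ for all $n > N$. -}

module Defs where

open import Data.Nat using (ℕ; zero; suc; _+_; _>_; NonZero)
open import Data.Nat.Divisibility using (_∣?_)
open import Data.Nat.DivMod using (_/_)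
open import Data.Product using (∃-syntax; _×_)
open import Relation.Nullary using (yes; no)
open import Relation.Binary.PropositionalEquality using (_≡_)

T : (a d : ℕ) → .{{NonZero d}} → ℕ → ℕ
T a d x with d ∣? x
... | yes _ = x / d
... | no  _ = x + a

iterT : (a d : ℕ) → .{{NonZero d}} → ℕ → ℕ → ℕ
iterT a d zero    x = x
iterT a d (suc k) x = T a d (iterT a d k x)

O : (a d : ℕ) → .{{NonZero d}} → ℕ → (ℕ → ℕ)
O a d x n = iterT a d n x

Loops : (ℕ → ℕ) → Set
Loops o = ∃[ k ] ∃[ N ] (k > 0 × N > 0 × (∀ n → n > N → o n ≡ o (n + k)))

{-# OPTIONS --safe #-}
module Submission where

-- A common divisor of a and d that divides 1 + n a divides 1, so when gcd(a, d) > 1 no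
-- term 1 + n a is a multiple of d. Hence the trajectory of 1 is 1, 1 + a, 1 + 2a, …,
-- which is injective since a > 0, and an injective sequence cannot loop.

open import Defs
open import Data.Nat using (ℕ; suc; _+_; _*_; _>_; NonZero; >-nonZero)
open import Data.Nat.Properties using (+-comm; suc-injective; *-cancelʳ-≡; m+1+n≢m; ≤-refl)
open import Data.Nat.Divisibility using (_∣_; _∣?_; ∣-trans; n∣m*n; ∣1⇒≡1; ∣m+n∣m⇒∣n)
open import Data.Nat.Coprimality using (Coprime)
open import Data.Product using (∃-syntax; _×_; _,_)
open import Data.Empty using (⊥-elim)
open import Function.Definitions using (Injective)
open import Relation.Nullary using (¬_; yes; no)
open import Relation.Binary.PropositionalEquality using (_≡_; refl; sym; cong; subst; trans)

injective⇒¬loops : ∀ {o : ℕ → ℕ} → Injective _≡_ _≡_ o → ¬ Loops o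
injective⇒¬loops inj (suc k , N , _ , _ , periodic) =
  m+1+n≢m (suc N) (sym (inj (periodic (suc N) ≤-refl)))

∣1+m*n⇒coprime : ∀ {m n d} → d ∣ 1 + m * n → Coprime n d
∣1+m*n⇒coprime {m} {n} {d} d∣1+mn {i} (i∣n , i∣d) =
  ∣1⇒≡1 (∣m+n∣m⇒∣n (subst (i ∣_) (+-comm 1 (m * n)) (∣-trans i∣d d∣1+mn))
                    (∣-trans i∣n (n∣m*n m)))

module _ (a d : ℕ) .{{_ : NonZero d}} where

  T-∤ : ∀ {x} → ¬ d ∣ x → T a d x ≡ x + a
  T-∤ {x} d∤x with d ∣? x
  ... | yes d∣x = ⊥-elim (d∤x d∣x)
  ... | no  _   = refl

  iterT-from-1 : ¬ Coprime a d → ∀ n → iterT a d n 1 ≡ 1 + n * a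
  iterT-from-1 _  0       = refl
  iterT-from-1 ¬c (suc n) rewrite iterT-from-1 ¬c n =
    trans (T-∤ (λ d∣1+na → ¬c (∣1+m*n⇒coprime {n} d∣1+na))) (cong suc (+-comm (n * a) a))

proposition1 : (a d : ℕ) → (a>0 : a > 0) → (d>0 : d > 0) → ¬ Coprime a d →
    ∃[ x ] (x > 0 × ¬ Loops (O a d {{>-nonZero d>0}} x))
proposition1 a d a>0 d>0 ¬c = 1 , ≤-refl , injective⇒¬loops orbit-injective
  where
  instance
    _ : NonZero d
    _ = >-nonZero d>0
    _ : NonZero a
    _ = >-nonZero a>0

  orbit-injective : Injective _≡_ _≡_ (O a d 1)
  orbit-injective {m} {n} eq = *-cancelʳ-≡ m n a (suc-injective
    (trans (sym (iterT-from-1 a d ¬c m)) (trans eq (iterT-from-1 a d ¬c n))))
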